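{- Let $\vdash$ be a set of sequents satisfying (A), (Mon), (Cut), (Com), ($\land$I), ($\land$E), ($\to$0), ($\to$1), ($\to$2). Let $\varphi$ be a formula and $\Gamma,\Delta$ sets of formulas. If $\Delta$ is nonempty and closed under $\land$, then $\Gamma(\Delta,\varphi)$ is closed, $\Delta\cup\{\varphi\}\subseteq\Gamma(\Delta,\varphi)$ and $\Gamma\,R_\to\,\Gamma(\Delta,\varphi)$; moreover, if $\Gamma$ is closed, then $\Gamma(\Delta,\varphi)$ is the smallest set of formulas having these three properties (i.e. it is contained in every closed $\Phi$ with $\Delta\cup\{\varphi\}\subseteq\Phi$ and $\Gamma R_\to\Phi$).
   Context: Formulas are generated by $\varphi::=p\mid\perp\mid(\varphi\land\varphi)\mid(\varphi\to\varphi)$ with $p$ from a countable set $P0$; $Form$ is the set of formulas; $\land$ is left-associative and binds tighter than $\to$. A sequent is $(\Gamma,\varphi)$ with $\Gamma\subseteq Form$; for a set $\vdash$ of sequents write $\Gamma\vdash\varphi$ for membership, $\psi\vdash\varphi$ for $\{\psi\}\vdash\varphi$, $\vdash\varphi$ for $\emptyset\vdash\varphi$. Rules (for all $\Gamma,\Delta\subseteq Form$, formulas $\varphi,\psi,\chi$): (A) $\Gamma\cup\{\varphi\}\vdash\varphi$; (Mon) $\Gamma\subseteq\Delta$, $\Gamma\vdash\varphi$ imply $\Delta\vdash\varphi$; (Cut) $\Gamma\cup\{\psi\}\vdash\varphi$, $\Delta\vdash\psi$ imply $\Gamma\cup\Delta\vdash\varphi$; (Com) if $\Gamma\vdash\varphi$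 then $\Gamma'\vdash\varphi$ for some finite $\Gamma'\subseteq\Gamma$; ($\land$I) $\{\varphi,\psi\}\vdash\varphi\land\psi$; ($\land$E) $\varphi\land\psi\vdash\varphi$, $\varphi\land\psi\vdash\psi$; ($\to$0) $\vdash\varphi\to\varphi$; ($\to$1) if $\Gamma\vdash\varphi$ then $\{\psi\to\chi:\chi\in\Gamma\}\vdash\psi\to\varphi$; ($\to$2) $\{\varphi\to\psi,\psi\to\chi\}\vdash\varphi\to\chi$. A set $\Gamma$ is closed if $\Gamma\vdash\psi$ implies $\psi\in\Gamma$. $\Delta$ is closed under $\land$ if $\alpha,\beta\in\Delta$ implies $\alpha\land\beta\in\Delta$. $\Gamma R_\to\Delta$ means: for all formulas $\varphi,\psi$, if $\varphi\to\psi\in\Gamma$ and $\varphi\in\Delta$ then $\psi\in\Delta$. $\Gamma(\Delta,\varphi)=\{\psi\in Form:\exists\alpha\in\Delta,\ \Gamma\vdash\alpha\land\varphi\to\psi\}$. -}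

module Defs where

open import Data.Nat using (ℕ)
open import Data.Product using (Σ; ∃; ∃-syntax; _×_; _,_)
open import Data.Sum using (_⊎_)
open import Data.List using (List)
open import Data.List.Membership.Propositional using (_∈_)
open import Relation.Binary.PropositionalEquality using (_≡_)

infixr 5 _⇒_
infixl 6 _∧_

data Form : Set where
  var : ℕ → Form
  bot : Form
  _∧_ : Form → Form → Form
  _⇒_ : Form → Form → Form

FSet : Set₁
FSet = Form → Set

_⊆_ : FSet → FSet → Set
Γ ⊆ Δ = ∀ φ → Γ φ → Δ φ

_∪_ : FSet → FSet → FSet
(Γ ∪ Δ) φ = Γ φ ⊎ Δ φ

｛_｝ : Form → FSet
｛ φ ｝ ψ = ψ ≡ φ

pair : Form → Form → FSet
pair φ ψ χ = (χ ≡ φ) ⊎ (χ ≡ ψ)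

∅ : FSet
∅ _ = Data.Empty.⊥
  where import Data.Empty

⟦_⟧ : List Form → FSet
⟦ xs ⟧ φ = φ ∈ xs

Cons : Set₁
Cons = FSet → Form → Set

record Rules (_⊢_ : Cons) : Set₁ where
  field
    A    : ∀ Γ φ → (Γ ∪ ｛ φ ｝) ⊢ φ
    Mon  : ∀ Γ Δ φ → Γ ⊆ Δ → Γ ⊢ φ → Δ ⊢ φ
    Cut  : ∀ Γ Δ φ ψ → (Γ ∪ ｛ ψ ｝) ⊢ φ → Δ ⊢ ψ → (Γ ∪ Δ) ⊢ φ
    Com  : ∀ Γ φ → Γ ⊢ φ → Σ (List Form) λ Γ' → (⟦ Γ' ⟧ ⊆ Γ) × (⟦ Γ' ⟧ ⊢ φ)
    ∧I   : ∀ φ ψ → pair φ ψ ⊢ (φ ∧ ψ)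
    ∧E₁  : ∀ φ ψ → ｛ φ ∧ ψ ｝ ⊢ φ
    ∧E₂  : ∀ φ ψ → ｛ φ ∧ ψ ｝ ⊢ ψ
    →0   : ∀ φ → ∅ ⊢ (φ ⇒ φ)
    →1   : ∀ Γ φ ψ → Γ ⊢ φ → (λ θ → ∃[ χ ] (Γ χ × θ ≡ (ψ ⇒ χ))) ⊢ (ψ ⇒ φ)
    →2   : ∀ φ ψ χ → pair (φ ⇒ ψ) (ψ ⇒ χ) ⊢ (φ ⇒ χ)

module _ (_⊢_ : Cons) where

  Closed : FSet → Set
  Closed Γ = ∀ ψ → Γ ⊢ ψ → Γ ψ

  GammaDφ : FSet → FSet → Form → FSet
  GammaDφ Γ Δ φ ψ = ∃[ α ] (Δ α × Γ ⊢ (α ∧ φ ⇒ ψ))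

Closed∧ : FSet → Set
Closed∧ Δ = ∀ α β → Δ α → Δ β → Δ (α ∧ β)

NonEmpty : FSet → Set
NonEmpty Δ = ∃[ α ] Δ α

R→ : FSet → FSet → Set
R→ Γ Δ = ∀ φ ψ → Γ (φ ⇒ ψ) → Δ φ → Δ ψ

{-# OPTIONS --safe #-}
-- Finitely many members of Γ(Δ,φ) share a common witness: if Γ ⊢ αᵢ ∧ φ → ψᵢ
-- with αᵢ ∈ Δ, then α = α₁ ∧ … ∧ αₙ ∈ Δ witnesses every ψᵢ, because
-- Γ ⊢ α ∧ φ → αᵢ ∧ φ. By compactness a consequence ψ of Γ(Δ,φ) follows from
-- such finitely many ψᵢ, and (→1) turns this into Γ ⊢ α ∧ φ → ψ, so Γ(Δ,φ) is
-- closed. Minimality: if Φ is closed and contains Δ and φ, it contains α ∧ φ,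
-- and Γ ⊢ α ∧ φ → ψ with Γ closed puts this implication in Γ, so R→ gives ψ ∈ Φ.
module Submission where

open import Defs
open import Data.Product using (_×_; _,_; ∃-syntax)
open import Data.Sum using (inj₁; inj₂)
open import Data.List using (List; []; _∷_)
open import Data.List.Relation.Unary.Any using (here; there)
open import Data.List.Membership.Propositional using (_∈_)
open import Relation.Binary.PropositionalEquality using (refl)

module DerivedRules (_⊢_ : Cons) (rules : Rules _⊢_) where
  open Rules rules

  assumption : ∀ Γ φ → Γ φ → Γ ⊢ φ
  assumption Γ φ φ∈Γ = Mon _ Γ φ (λ { _ (inj₁ ψ∈Γ) → ψ∈Γ ; _ (inj₂ refl) → φ∈Γ }) (A Γ φ)

  discharge : ∀ Γ ψ (L : List Form) → (⟦ L ⟧ ∪ Γ) ⊢ ψ → (∀ χ → χ ∈ L → Γ ⊢ χ) → Γ ⊢ ψ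
  discharge Γ ψ [] ⊢ψ _ = Mon _ Γ ψ (λ { _ (inj₁ ()) ; _ (inj₂ χ∈Γ) → χ∈Γ }) ⊢ψ
  discharge Γ ψ (χ ∷ L) ⊢ψ ⊢L =
    discharge Γ ψ L
      (Mon _ _ ψ (λ { _ (inj₁ θ∈) → θ∈ ; _ (inj₂ θ∈Γ) → inj₂ θ∈Γ })
        (Cut (⟦ L ⟧ ∪ Γ) Γ ψ χ (Mon _ _ ψ isolate-χ ⊢ψ) (⊢L χ (here refl))))
      (λ θ θ∈L → ⊢L θ (there θ∈L))
    where
    isolate-χ : (⟦ χ ∷ L ⟧ ∪ Γ) ⊆ ((⟦ L ⟧ ∪ Γ) ∪ ｛ χ ｝)
    isolate-χ _ (inj₁ (here refl)) = inj₂ refl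
    isolate-χ _ (inj₁ (there θ∈L)) = inj₁ (inj₁ θ∈L)
    isolate-χ _ (inj₂ θ∈Γ) = inj₁ (inj₂ θ∈Γ)

  cut* : ∀ S Γ ψ → S ⊢ ψ → (∀ χ → S χ → Γ ⊢ χ) → Γ ⊢ ψ
  cut* S Γ ψ S⊢ψ Γ⊢S with Com S ψ S⊢ψ
  ... | L , L⊆S , L⊢ψ = discharge Γ ψ L (Mon _ _ ψ (λ _ → inj₁) L⊢ψ) (λ χ χ∈L → Γ⊢S χ (L⊆S χ χ∈L))

  ∧-intro : ∀ Γ φ ψ → Γ ⊢ φ → Γ ⊢ ψ → Γ ⊢ (φ ∧ ψ)
  ∧-intro Γ φ ψ ⊢φ ⊢ψ = cut* _ Γ _ (∧I φ ψ) (λ { _ (inj₁ refl) → ⊢φ ; _ (inj₂ refl) → ⊢ψ })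

  ∧-elimˡ : ∀ Γ φ ψ → Γ ⊢ (φ ∧ ψ) → Γ ⊢ φ
  ∧-elimˡ Γ φ ψ ⊢φ∧ψ = cut* _ Γ _ (∧E₁ φ ψ) (λ { _ refl → ⊢φ∧ψ })

  ∧-elimʳ : ∀ Γ φ ψ → Γ ⊢ (φ ∧ ψ) → Γ ⊢ ψ
  ∧-elimʳ Γ φ ψ ⊢φ∧ψ = cut* _ Γ _ (∧E₂ φ ψ) (λ { _ refl → ⊢φ∧ψ })

  ⇒-trans : ∀ Γ φ ψ χ → Γ ⊢ (φ ⇒ ψ) → Γ ⊢ (ψ ⇒ χ) → Γ ⊢ (φ ⇒ χ)
  ⇒-trans Γ φ ψ χ ⊢φ⇒ψ ⊢ψ⇒χ =
    cut* _ Γ _ (→2 φ ψ χ) (λ { _ (inj₁ refl) → ⊢φ⇒ψ ; _ (inj₂ refl) → ⊢ψ⇒χ })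

  ⇒-cut* : ∀ S Γ θ ψ → S ⊢ ψ → (∀ χ → S χ → Γ ⊢ (θ ⇒ χ)) → Γ ⊢ (θ ⇒ ψ)
  ⇒-cut* S Γ θ ψ S⊢ψ Γ⊢θ⇒S =
    cut* _ Γ _ (→1 S ψ θ S⊢ψ) (λ { _ (χ , χ∈S , refl) → Γ⊢θ⇒S χ χ∈S })

  ⇒-from-⊢ : ∀ Γ φ ψ → ｛ φ ｝ ⊢ ψ → Γ ⊢ (φ ⇒ ψ)
  ⇒-from-⊢ Γ φ ψ φ⊢ψ = ⇒-cut* ｛ φ ｝ Γ φ ψ φ⊢ψ (λ { _ refl → Mon ∅ Γ _ (λ _ ()) (→0 φ) })

  ⊢∧⇒ˡ : ∀ Γ φ ψ → Γ ⊢ (φ ∧ ψ ⇒ φ)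
  ⊢∧⇒ˡ Γ φ ψ = ⇒-from-⊢ Γ _ _ (∧E₁ φ ψ)

  ⊢∧⇒ʳ : ∀ Γ φ ψ → Γ ⊢ (φ ∧ ψ ⇒ ψ)
  ⊢∧⇒ʳ Γ φ ψ = ⇒-from-⊢ Γ _ _ (∧E₂ φ ψ)

  ⊢∧-∧⇒ˡ : ∀ Γ α β φ → Γ ⊢ (α ∧ β ∧ φ ⇒ α ∧ φ)
  ⊢∧-∧⇒ˡ Γ α β φ = ⇒-from-⊢ Γ _ _ (∧-intro _ α φ
    (∧-elimˡ _ α β (∧-elimˡ _ (α ∧ β) φ (assumption _ _ refl)))
    (∧-elimʳ _ (α ∧ β) φ (assumption _ _ refl)))

  ⊢∧-∧⇒ʳ : ∀ Γ α β φ → Γ ⊢ (α ∧ β ∧ φ ⇒ β ∧ φ)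
  ⊢∧-∧⇒ʳ Γ α β φ = ⇒-from-⊢ Γ _ _ (∧-intro _ β φ
    (∧-elimʳ _ α β (∧-elimˡ _ (α ∧ β) φ (assumption _ _ refl)))
    (∧-elimʳ _ (α ∧ β) φ (assumption _ _ refl)))

module GammaDφProperties (_⊢_ : Cons) (rules : Rules _⊢_) where
  open Rules rules
  open DerivedRules _⊢_ rules

  common-witness : ∀ φ Γ Δ → NonEmpty Δ → Closed∧ Δ → (L : List Form) → ⟦ L ⟧ ⊆ GammaDφ _⊢_ Γ Δ φ →
    ∃[ α ] (Δ α × (∀ ψ → ψ ∈ L → Γ ⊢ (α ∧ φ ⇒ ψ)))
  common-witness φ Γ Δ (α₀ , α₀∈Δ) _ [] _ = α₀ , α₀∈Δ , λ _ ()
  common-witness φ Γ Δ Δ≠∅ Δ∧ (ψ ∷ L) ψ∷L⊆ with common-witness φ Γ Δ Δ≠∅ Δ∧ L (λ χ χ∈L → ψ∷L⊆ χ (there χ∈L))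
                                                 | ψ∷L⊆ ψ (here refl)
  ... | α , α∈Δ , ⊢L | β , β∈Δ , ⊢ψ =
    α ∧ β , Δ∧ α β α∈Δ β∈Δ ,
    λ { _ (here refl) → ⇒-trans Γ _ _ _ (⊢∧-∧⇒ʳ Γ α β φ) ⊢ψ
      ; χ (there χ∈L) → ⇒-trans Γ _ _ _ (⊢∧-∧⇒ˡ Γ α β φ) (⊢L χ χ∈L) }

  GammaDφ-closed : ∀ φ Γ Δ → NonEmpty Δ → Closed∧ Δ → Closed _⊢_ (GammaDφ _⊢_ Γ Δ φ)
  GammaDφ-closed φ Γ Δ Δ≠∅ Δ∧ ψ ⊢ψ with Com _ ψ ⊢ψ
  ... | L , L⊆ , L⊢ψ with common-witness φ Γ Δ Δ≠∅ Δ∧ L L⊆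
  ... | α , α∈Δ , ⊢L = α , α∈Δ , ⇒-cut* ⟦ L ⟧ Γ (α ∧ φ) ψ L⊢ψ ⊢L

  GammaDφ-⊇ : ∀ φ Γ Δ → NonEmpty Δ → (Δ ∪ ｛ φ ｝) ⊆ GammaDφ _⊢_ Γ Δ φ
  GammaDφ-⊇ φ Γ Δ _ δ (inj₁ δ∈Δ) = δ , δ∈Δ , ⊢∧⇒ˡ Γ δ φ
  GammaDφ-⊇ φ Γ Δ (α₀ , α₀∈Δ) _ (inj₂ refl) = α₀ , α₀∈Δ , ⊢∧⇒ʳ Γ α₀ φ

  GammaDφ-R→ : ∀ φ Γ Δ → R→ Γ (GammaDφ _⊢_ Γ Δ φ)
  GammaDφ-R→ φ Γ Δ ψ χ ψ⇒χ∈Γ (α , α∈Δ , ⊢ψ) = α , α∈Δ , ⇒-trans Γ _ _ _ ⊢ψ (assumption Γ _ ψ⇒χ∈Γ)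

  GammaDφ-least : ∀ φ Γ Δ → Closed _⊢_ Γ → (Φ : FSet) → Closed _⊢_ Φ → (Δ ∪ ｛ φ ｝) ⊆ Φ → R→ Γ Φ →
    GammaDφ _⊢_ Γ Δ φ ⊆ Φ
  GammaDφ-least φ Γ Δ Γ-closed Φ Φ-closed Δφ⊆Φ Γ-R→-Φ ψ (α , α∈Δ , ⊢α∧φ⇒ψ) =
    Γ-R→-Φ (α ∧ φ) ψ (Γ-closed _ ⊢α∧φ⇒ψ) (Φ-closed _ (∧-intro Φ α φ
      (assumption Φ α (Δφ⊆Φ α (inj₁ α∈Δ)))
      (assumption Φ φ (Δφ⊆Φ φ (inj₂ refl)))))

lemma13 : (_⊢_ : Cons) → Rules _⊢_ →
    (φ : Form) (Γ Δ : FSet) → NonEmpty Δ → Closed∧ Δ →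
    (Closed _⊢_ (GammaDφ _⊢_ Γ Δ φ)
      × ((Δ ∪ ｛ φ ｝) ⊆ GammaDφ _⊢_ Γ Δ φ)
      × R→ Γ (GammaDφ _⊢_ Γ Δ φ))
    × (Closed _⊢_ Γ → (Φ : FSet) → Closed _⊢_ Φ → (Δ ∪ ｛ φ ｝) ⊆ Φ → R→ Γ Φ →
        GammaDφ _⊢_ Γ Δ φ ⊆ Φ)
lemma13 _⊢_ rules φ Γ Δ Δ≠∅ Δ∧ =
  ( GammaDφ-closed φ Γ Δ Δ≠∅ Δ∧
  , GammaDφ-⊇ φ Γ Δ Δ≠∅
  , GammaDφ-R→ φ Γ Δ )
  , GammaDφ-least φ Γ Δ
  where open GammaDφProperties _⊢_ rules
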